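{- Let $k\ge0$ and $n\in[2^k,2^{k+1})$. Then $$M(n)\begin{bmatrix}1\\1\end{bmatrix}=\begin{bmatrix}q^{ -k}h_q(n-1)\\ q^{ -k-1}h_q(n)\end{bmatrix}.$$
   Context: $h_q(n)=\sum_\eta q^{\ell(\eta)}$ over hyperbinary partitions $\eta$ of $n$ (partitions into powers of $2$, each part used at most twice), $\ell(\eta)$ = number of parts; $h_q(0)=1$. Let $L=\begin{bmatrix}1&0\\1&q^{ -1}\end{bmatrix}$, $R=\begin{bmatrix}q&1\\0&1\end{bmatrix}$. For $n\ge1$ with binary expansion $\beta(n)=b_1b_2\cdots b_{k+1}$ ($b_1=1$ most significant), $M(n)$ is the product obtained from the word $b_{k+1}b_k\cdots b_2$ by replacing each $0$ by $L$ and each $1$ by $R$ (empty product = identity). -}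

module Defs where

open import Level using (Level)
open import Algebra.Bundles using (CommutativeRing)
open import Data.Nat using (ℕ; zero; suc; _≟_)
import Data.Nat as ℕ
open import Data.Fin using (Fin; toℕ)
open import Data.Vec using (Vec; []; _∷_)
open import Data.List using (List; []; _∷_; map; concatMap; reverse; drop; foldr)
open import Data.Bool using (Bool; true; false)
open import Data.Product using (_×_; _,_)
open import Relation.Nullary using (yes; no)

allFin3 : List (Fin 3)
allFin3 = Fin.zero ∷ Fin.suc Fin.zero ∷ Fin.suc (Fin.suc Fin.zero) ∷ []
  where import Data.Fin as Fin

allVecs : (n : ℕ) → List (Vec (Fin 3) n)
allVecs zero = [] ∷ []
allVecs (suc n) = concatMap (λ m → map (m ∷_) (allVecs n)) allFin3

-- A hyperbinary partition of n is encoded by its multiplicity vector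
-- (m_0 , … , m_{n-1}), m_i ∈ {0,1,2} = multiplicity of the part 2^i.
-- (Parts 2^i with i ≥ n exceed n, so they never occur.)
-- value: the integer partitioned, Σ m_i 2^i
value : ∀ {n} → Vec (Fin 3) n → ℕ
value [] = 0
value (m ∷ v) = toℕ m ℕ.+ 2 ℕ.* value v

numParts : ∀ {n} → Vec (Fin 3) n → ℕ
numParts [] = 0
numParts (m ∷ v) = toℕ m ℕ.+ numParts v

hyperbinary : (n : ℕ) → List (Vec (Fin 3) n)
hyperbinary n = go (allVecs n)
  where
  go : List (Vec (Fin 3) n) → List (Vec (Fin 3) n)
  go [] = []
  go (v ∷ vs) with value v ≟ n
  ... | yes _ = v ∷ go vs
  ... | no  _ = go vs

-- binary expansion, least significant bit first (fuel-based; fuel n suffices)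
bitsLSB-aux : ℕ → ℕ → List Bool
bitsLSB-aux zero _ = []
bitsLSB-aux (suc f) zero = []
bitsLSB-aux (suc f) (suc n) with Data.Nat.DivMod._%_ (suc n) 2 | Data.Nat.DivMod._/_ (suc n) 2
  where import Data.Nat.DivMod
... | r | d = (r ℕ.≡ᵇ 1) ∷ bitsLSB-aux f d

-- β(n) = b₁ b₂ … b_{k+1}, most significant bit first (β(0) = empty)
β : ℕ → List Bool
β n = reverse (bitsLSB-aux n n)

-- Computations over a commutative ring R with an element q and a chosen
-- inverse q⁻ (q * q⁻ ≈ 1 is assumed in the theorem).  Since Z[q,q⁻¹] is the
-- free commutative ring on a unit, identities for all such (R, q, q⁻) are
-- exactly identities of Laurent polynomials.
module Over {c ℓ : Level} (R : CommutativeRing c ℓ) (q q⁻ : CommutativeRing.Carrier R) where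
  open CommutativeRing R

  pow : Carrier → ℕ → Carrier
  pow x zero = 1#
  pow x (suc n) = x * pow x n

  sumR : List Carrier → Carrier
  sumR = foldr _+_ 0#

  h : ℕ → Carrier
  h n = sumR (map (λ v → pow q (numParts v)) (hyperbinary n))

  Mat : Set c
  Mat = (Carrier × Carrier) × (Carrier × Carrier)

  _⊗_ : Mat → Mat → Mat
  ((a , b) , (c' , d)) ⊗ ((e , f) , (g , k)) =
    ((a * e + b * g , a * f + b * k) , (c' * e + d * g , c' * f + d * k))

  I : Mat
  I = ((1# , 0#) , (0# , 1#))

  L : Mat
  L = ((1# , 0#) , (1# , q⁻))

  Rm : Mat
  Rm = ((q , 1#) , (0# , 1#))

  letter : Bool → Mat
  letter false = L
  letter true = Rm

  prod : List Bool → Mat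
  prod = foldr (λ b m → letter b ⊗ m) I

  -- M(n): word b_{k+1} b_k … b_2 = reverse of (β(n) without b₁)
  M : ℕ → Mat
  M n = prod (reverse (drop 1 (β n)))

  _·_ : Mat → Carrier × Carrier → Carrier × Carrier
  ((a , b) , (c' , d)) · (x , y) = (a * x + b * y , c' * x + d * y)

  fst snd : Carrier × Carrier → Carrier
  fst (x , _) = x
  snd (_ , y) = y

{-# OPTIONS --safe #-}
-- Reading the binary expansion of n from the right, M(2m) = L M(m) and M(2m+1) = R M(m)
-- for m ≥ 1.  Splitting a hyperbinary partition according to the multiplicity (0, 1 or 2)
-- of the part 1 gives h(2m+1) = q h(m) and h(2m+2) = h(m+1) + q² h(m).  Left
-- multiplication by L or R turns the claimed column for m into the one for 2m or 2m+1
-- precisely by these recurrences (using q q⁻¹ = 1), so induction on k from M(1) = I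
-- proves the theorem.
module Submission where

open import Defs
open import Algebra.Bundles using (CommutativeRing)
open import Data.Nat using (ℕ; suc; _^_; _≤_; _<_; _∸_)
open import Data.Product using (_×_; _,_)
open import Data.Product.Relation.Binary.Pointwise.NonDependent using (Pointwise; ×-setoid)

open import Data.Bool using (Bool; true; false)
open import Data.Fin using (Fin; toℕ; #_)
open import Data.List using (List; []; _∷_; _++_; [_]; _∷ʳ_; map; concatMap; reverse; drop; initLast; _∷ʳ′_)
open import Data.List.Properties using (map-∘; reverse-++; reverse-involutive)
open import Data.Nat using (zero; z≤n; s≤s; _≟_; _≡ᵇ_; _≤′_; ≤′-refl; ≤′-step)
open import Data.Nat.DivMod using (_%_; _/_; %-congˡ; /-congˡ; m*n%n≡0; m*n/n≡m; [m+kn]%n≡m%n; +-distrib-/; m/n<m)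
open import Data.Nat.Properties
  using (≤-refl; ≤-trans; ≤-pred; <-trans; <-≤-trans; n≤1+n; <⇒≱; n<1+n; m<m+n; m≤n*m; m^n>0;
         *-suc; suc-injective; +-cancelˡ-≡; *-cancelˡ-≡; *-cancelˡ-≤; *-cancelˡ-<; ≤⇒≤′; ≤′⇒≤)
open import Data.Parity.Base using (0ℙ; _⁻¹)
open import Data.Parity.Properties using (p≢p⁻¹; +-homo-+; *-homo-*)
open import Data.Vec as Vec using (Vec)
open import Function using (_∘_)
open import Relation.Binary.PropositionalEquality as ≡ using (_≡_; _≢_; cong; cong₂; subst)
open import Relation.Nullary using (yes; no; contradiction)
import Algebra.Solver.Ring.NaturalCoefficients.Default
import Data.Nat as ℕ

module _ where
  open import Data.Nat using (_+_; _*_; parity)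
  open ≡ using (refl; sym; trans)
  open import Data.Nat.Properties using (*-comm; ≤∧≢⇒<)

  even≢odd : ∀ m n → 2 * m ≢ 1 + 2 * n
  even≢odd m n eq = p≢p⁻¹ 0ℙ (begin
    0ℙ                  ≡⟨ *-homo-* 2 m ⟨
    parity (2 * m)      ≡⟨ cong parity eq ⟩
    parity (1 + 2 * n)  ≡⟨ +-homo-+ 1 (2 * n) ⟩
    parity (2 * n) ⁻¹   ≡⟨ cong _⁻¹ (*-homo-* 2 n) ⟩
    0ℙ ⁻¹               ∎)
    where open ≡.≡-Reasoning

  2*m≤1+2*n⇒m≤n : ∀ {m n} → 2 * m ≤ 1 + 2 * n → m ≤ n
  2*m≤1+2*n⇒m≤n {m} {n} le = *-cancelˡ-≤ 2 (≤-pred (≤∧≢⇒< le (even≢odd m n)))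

  data EvenOdd : ℕ → Set where
    even : ∀ m → EvenOdd (2 * m)
    odd  : ∀ m → EvenOdd (1 + 2 * m)

  evenOdd : ∀ n → EvenOdd n
  evenOdd zero = even 0
  evenOdd (suc n) with evenOdd n
  ... | even m = odd m
  ... | odd m  = subst EvenOdd (*-suc 2 m) (even (suc m))

  [2*m]%2≡0 : ∀ m → (2 * m) % 2 ≡ 0
  [2*m]%2≡0 m = trans (%-congˡ {o = 2} (*-comm 2 m)) (m*n%n≡0 m 2)

  [2*m]/2≡m : ∀ m → (2 * m) / 2 ≡ m
  [2*m]/2≡m m = trans (/-congˡ {o = 2} (*-comm 2 m)) (m*n/n≡m m 2)

  [1+2*m]%2≡1 : ∀ m → (1 + 2 * m) % 2 ≡ 1
  [1+2*m]%2≡1 m = trans (%-congˡ {o = 2} (cong suc (*-comm 2 m))) ([m+kn]%n≡m%n 1 m 2)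

  [1+2*m]/2≡m : ∀ m → (1 + 2 * m) / 2 ≡ m
  [1+2*m]/2≡m m = trans (+-distrib-/ 1 (2 * m) 1+[2*m]%2<2) ([2*m]/2≡m m)
    where
    1+[2*m]%2<2 : 1 % 2 + (2 * m) % 2 < 2
    1+[2*m]%2<2 = subst (λ r → 1 + r < 2) (sym ([2*m]%2≡0 m)) ≤-refl

  bitsLSB : ℕ → List Bool
  bitsLSB n = bitsLSB-aux n n

  bitsLSB-aux-fuel : ∀ {f g n} → n ≤ f → n ≤ g → bitsLSB-aux f n ≡ bitsLSB-aux g n
  bitsLSB-aux-fuel {zero}  {zero}  {zero}  _         _         = refl
  bitsLSB-aux-fuel {zero}  {suc g} {zero}  _         _         = refl
  bitsLSB-aux-fuel {suc f} {zero}  {zero}  _         _         = refl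
  bitsLSB-aux-fuel {suc f} {suc g} {zero}  _         _         = refl
  bitsLSB-aux-fuel {suc f} {suc g} {suc n} (s≤s n≤f) (s≤s n≤g) =
    cong (_ ∷_) (bitsLSB-aux-fuel (≤-trans half≤n n≤f) (≤-trans half≤n n≤g))
    where
    half≤n : suc n / 2 ≤ n
    half≤n = ≤-pred (m/n<m (suc n) 2 (s≤s (s≤s z≤n)))

  bitsLSB-suc : ∀ n → bitsLSB (suc n) ≡ (suc n % 2 ≡ᵇ 1) ∷ bitsLSB (suc n / 2)
  bitsLSB-suc n = cong ((suc n % 2 ≡ᵇ 1) ∷_) (bitsLSB-aux-fuel (≤-pred (m/n<m (suc n) 2 (s≤s (s≤s z≤n)))) ≤-refl)

  bitsLSB-even : ∀ m → bitsLSB (2 * suc m) ≡ false ∷ bitsLSB (suc m)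
  bitsLSB-even m = trans (bitsLSB-suc _) (cong₂ _∷_ (cong (_≡ᵇ 1) ([2*m]%2≡0 (suc m))) (cong bitsLSB ([2*m]/2≡m (suc m))))

  bitsLSB-odd : ∀ m → bitsLSB (1 + 2 * m) ≡ true ∷ bitsLSB m
  bitsLSB-odd m = trans (bitsLSB-suc _) (cong₂ _∷_ (cong (_≡ᵇ 1) ([1+2*m]%2≡1 m)) (cong bitsLSB ([1+2*m]/2≡m m)))

module _ {a} {A : Set a} where
  open ≡ using (refl; sym; trans)

  dropLast : List A → List A
  dropLast xs = reverse (drop 1 (reverse xs))

  dropLast-∷ʳ : ∀ xs (x : A) → dropLast (xs ∷ʳ x) ≡ xs
  dropLast-∷ʳ xs x = trans (cong (reverse ∘ drop 1) (reverse-++ xs [ x ])) (reverse-involutive xs)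

  dropLast-∷ : ∀ (x : A) {ys} → ys ≢ [] → dropLast (x ∷ ys) ≡ x ∷ dropLast ys
  dropLast-∷ x {ys} ys≢[] with initLast ys
  ... | []       = contradiction refl ys≢[]
  ... | zs ∷ʳ′ z = trans (dropLast-∷ʳ (x ∷ zs) z) (cong (x ∷_) (sym (dropLast-∷ʳ zs z)))

module HyperbinaryRecurrences {c ℓ} (R : CommutativeRing c ℓ) (q q⁻ : CommutativeRing.Carrier R) where
  open CommutativeRing R
  open Over R q q⁻
  open import Algebra.Properties.CommutativeSemigroup *-commutativeSemigroup using (x∙yz≈y∙xz)
  open import Relation.Binary.Reasoning.Setoid setoid
  open Algebra.Solver.Ring.NaturalCoefficients.Default commutativeSemiring using (solve; _:+_; _:*_; _:=_; con)

  ∑ : ∀ {A : Set} → List A → (A → Carrier) → Carrier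
  ∑ xs f = sumR (map f xs)

  ∑-++ : ∀ {A : Set} (xs ys : List A) f → ∑ (xs ++ ys) f ≈ ∑ xs f + ∑ ys f
  ∑-++ []       ys f = sym (+-identityˡ _)
  ∑-++ (x ∷ xs) ys f = trans (+-congˡ (∑-++ xs ys f)) (sym (+-assoc _ _ _))

  ∑-concatMap : ∀ {A B : Set} (g : A → List B) xs f → ∑ (concatMap g xs) f ≈ ∑ xs (λ x → ∑ (g x) f)
  ∑-concatMap g []       f = refl
  ∑-concatMap g (x ∷ xs) f = trans (∑-++ (g x) _ f) (+-congˡ (∑-concatMap g xs f))

  ∑-map : ∀ {A B : Set} (g : A → B) xs f → ∑ (map g xs) f ≡ ∑ xs (f ∘ g)
  ∑-map g xs f = cong sumR (≡.sym (map-∘ xs))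

  ∑-cong : ∀ {A : Set} xs {f g : A → Carrier} → (∀ x → f x ≈ g x) → ∑ xs f ≈ ∑ xs g
  ∑-cong []       f≈g = refl
  ∑-cong (x ∷ xs) f≈g = +-cong (f≈g x) (∑-cong xs f≈g)

  ∑-*ˡ : ∀ {A : Set} a xs (f : A → Carrier) → ∑ xs (λ x → a * f x) ≈ a * ∑ xs f
  ∑-*ˡ a []       f = sym (zeroʳ a)
  ∑-*ˡ a (x ∷ xs) f = trans (+-congˡ (∑-*ˡ a xs f)) (sym (distribˡ a _ _))

  pow-+ : ∀ x m n → pow x (m ℕ.+ n) ≈ pow x m * pow x n
  pow-+ x zero    n = sym (*-identityˡ _)
  pow-+ x (suc m) n = trans (*-congˡ (pow-+ x m n)) (sym (*-assoc _ _ _))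

  δ : ℕ → ℕ → Carrier
  δ m n with m ≟ n
  ... | yes _ = 1#
  ... | no  _ = 0#

  δ-≢ : ∀ {m n} → m ≢ n → δ m n ≡ 0#
  δ-≢ {m} {n} m≢n with m ≟ n
  ... | yes m≡n = contradiction m≡n m≢n
  ... | no  _   = ≡.refl

  δ-digit : ∀ d m n → δ (d ℕ.+ 2 ℕ.* m) (d ℕ.+ 2 ℕ.* n) ≡ δ m n
  δ-digit d m n with d ℕ.+ 2 ℕ.* m ≟ d ℕ.+ 2 ℕ.* n | m ≟ n
  ... | yes _  | yes _   = ≡.refl
  ... | no  _  | no  _   = ≡.refl
  ... | yes eq | no  m≢n = contradiction (*-cancelˡ-≡ m n 2 (+-cancelˡ-≡ d _ _ eq)) m≢n
  ... | no  ne | yes ≡.refl = contradiction ≡.refl ne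

  hTerm : ℕ → ∀ {N} → Vec (Fin 3) N → Carrier
  hTerm n v = δ (value v) n * pow q (numParts v)

  -- h restricted to partitions with parts among 2^0, …, 2^(N-1)
  hTrunc : ℕ → ℕ → Carrier
  hTrunc N n = ∑ (allVecs N) (hTerm n)

  -- `hyperbinary` filters with a local function that cannot be named here, so the type
  -- of the induction over the filtered list is left to be inferred from its use.
  mutual
    h≈hTrunc : ∀ n → h n ≈ hTrunc n n
    h≈hTrunc n with allVecs n
    ... | vs = filter-∑ n vs

    filter-∑ : ∀ n (vs : List (Vec (Fin 3) n)) → _
    filter-∑ n []       = refl
    filter-∑ n (v ∷ vs) with value v ≟ n
    ... | yes _ = +-cong (sym (*-identityˡ _)) (filter-∑ n vs)
    ... | no  _ = trans (filter-∑ n vs) (sym (trans (+-congʳ (zeroˡ _)) (+-identityˡ _)))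

  digitSum : ℕ → ℕ → Fin 3 → Carrier
  digitSum N n d = ∑ (allVecs N) (λ v → hTerm n (d Vec.∷ v))

  -- Split by the multiplicity d of the part 1; halving the remaining parts leaves a
  -- partition of (n - d)/2.
  hTrunc-digits : ∀ N n {x y z} → digitSum N n (# 0) ≈ x → digitSum N n (# 1) ≈ y → digitSum N n (# 2) ≈ z →
                  hTrunc (suc N) n ≈ x + (y + (z + 0#))
  hTrunc-digits N n {x} {y} {z} e₀ e₁ e₂ = begin
    hTrunc (suc N) n                 ≈⟨ ∑-concatMap (λ d → map (d Vec.∷_) (allVecs N)) allFin3 (hTerm n) ⟩
    ∑ allFin3 (λ d → ∑ (map (d Vec.∷_) (allVecs N)) (hTerm n))
      ≈⟨ ∑-cong allFin3 (λ d → reflexive (∑-map (d Vec.∷_) (allVecs N) (hTerm n))) ⟩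
    ∑ allFin3 (digitSum N n)         ≈⟨ +-cong e₀ (+-cong e₁ (+-cong e₂ refl)) ⟩
    x + (y + (z + 0#))               ∎

  digit-present : ∀ N d j → digitSum N (toℕ d ℕ.+ 2 ℕ.* j) d ≈ pow q (toℕ d) * hTrunc N j
  digit-present N d j = trans (∑-cong (allVecs N) shift-digit) (∑-*ˡ (pow q (toℕ d)) (allVecs N) (hTerm j))
    where
    shift-digit : ∀ v → hTerm (toℕ d ℕ.+ 2 ℕ.* j) (d Vec.∷ v) ≈ pow q (toℕ d) * hTerm j v
    shift-digit v = trans (*-cong (reflexive (δ-digit (toℕ d) (value v) j)) (pow-+ q (toℕ d) (numParts v)))
                          (x∙yz≈y∙xz _ _ _)

  digit-absent : ∀ N n d → (∀ m → toℕ d ℕ.+ 2 ℕ.* m ≢ n) → digitSum N n d ≈ 0#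
  digit-absent N n d ≢n = begin
    digitSum N n d
      ≈⟨ ∑-cong (allVecs N) (λ v → *-congʳ (reflexive (δ-≢ (≢n (value v))))) ⟩
    ∑ (allVecs N) (λ v → 0# * pow q (numParts (d Vec.∷ v)))
      ≈⟨ ∑-*ˡ 0# (allVecs N) _ ⟩
    0# * _
      ≈⟨ zeroˡ _ ⟩
    0# ∎

  hTrunc-zero : ∀ N → hTrunc (suc N) 0 ≈ hTrunc N 0
  hTrunc-zero N = begin
    hTrunc (suc N) 0
      ≈⟨ hTrunc-digits N 0 (digit-present N (# 0) 0) (digit-absent N 0 (# 1) λ _ ()) (digit-absent N 0 (# 2) λ _ ()) ⟩
    1# * hTrunc N 0 + (0# + (0# + 0#))
      ≈⟨ solve 1 (λ X → con 1 :* X :+ (con 0 :+ (con 0 :+ con 0)) := X) refl (hTrunc N 0) ⟩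
    hTrunc N 0 ∎

  hTrunc-odd : ∀ N m → hTrunc (suc N) (1 ℕ.+ 2 ℕ.* m) ≈ q * hTrunc N m
  hTrunc-odd N m = begin
    hTrunc (suc N) (1 ℕ.+ 2 ℕ.* m)
      ≈⟨ hTrunc-digits N (1 ℕ.+ 2 ℕ.* m) (digit-absent N _ (# 0) λ x → even≢odd x m) (digit-present N (# 1) m)
                       (digit-absent N _ (# 2) λ x eq → even≢odd m x (≡.sym (suc-injective eq))) ⟩
    0# + ((q * 1#) * hTrunc N m + (0# + 0#))
      ≈⟨ solve 2 (λ q X → con 0 :+ ((q :* con 1) :* X :+ (con 0 :+ con 0)) := q :* X) refl q (hTrunc N m) ⟩
    q * hTrunc N m ∎

  hTrunc-even : ∀ N j → hTrunc (suc N) (2 ℕ.* suc j) ≈ hTrunc N (suc j) + q * (q * hTrunc N j)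
  hTrunc-even N j = begin
    hTrunc (suc N) (2 ℕ.* suc j)
      ≈⟨ hTrunc-digits N (2 ℕ.* suc j) (digit-present N (# 0) (suc j))
                       (digit-absent N _ (# 1) λ x eq → even≢odd (suc j) x (≡.sym eq))
                       (trans (reflexive (cong (λ n → digitSum N n (# 2)) (*-suc 2 j))) (digit-present N (# 2) j)) ⟩
    1# * hTrunc N (suc j) + (0# + ((q * (q * 1#)) * hTrunc N j + 0#))
      ≈⟨ solve 3 (λ q X Y → con 1 :* X :+ (con 0 :+ ((q :* (q :* con 1)) :* Y :+ con 0)) := X :+ q :* (q :* Y))
               refl q (hTrunc N (suc j)) (hTrunc N j) ⟩
    hTrunc N (suc j) + q * (q * hTrunc N j) ∎

  hTrunc-stable : ∀ N n → n ≤ N → hTrunc (suc N) n ≈ hTrunc N n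
  hTrunc-stable N n n≤N with evenOdd n
  hTrunc-stable N       _ _   | even zero = hTrunc-zero N
  hTrunc-stable zero    _ ()  | even (suc j)
  hTrunc-stable zero    _ ()  | odd m
  hTrunc-stable (suc N) _ n≤N | even (suc j) = begin
    hTrunc (2 ℕ.+ N) (2 ℕ.* suc j)
      ≈⟨ hTrunc-even (suc N) j ⟩
    hTrunc (suc N) (suc j) + q * (q * hTrunc (suc N) j)
      ≈⟨ +-cong (hTrunc-stable N (suc j) 1+j≤N) (*-congˡ (*-congˡ (hTrunc-stable N j (≤-trans (n≤1+n j) 1+j≤N)))) ⟩
    hTrunc N (suc j) + q * (q * hTrunc N j)
      ≈⟨ hTrunc-even N j ⟨
    hTrunc (suc N) (2 ℕ.* suc j) ∎
    where
    1+j≤N : suc j ≤ N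
    1+j≤N = ≤-pred (<-≤-trans (m<m+n (suc j) (s≤s z≤n)) n≤N)
  hTrunc-stable (suc N) _ n≤N | odd m = begin
    hTrunc (2 ℕ.+ N) (1 ℕ.+ 2 ℕ.* m)   ≈⟨ hTrunc-odd (suc N) m ⟩
    q * hTrunc (suc N) m               ≈⟨ *-congˡ (hTrunc-stable N m (≤-pred (≤-trans (s≤s (m≤n*m m 2)) n≤N))) ⟩
    q * hTrunc N m                     ≈⟨ hTrunc-odd N m ⟨
    hTrunc (suc N) (1 ℕ.+ 2 ℕ.* m)     ∎

  hTrunc≈h : ∀ {n} N → n ≤ N → hTrunc N n ≈ h n
  hTrunc≈h {n} _ n≤N = go (≤⇒≤′ n≤N)
    where
    go : ∀ {N} → n ≤′ N → hTrunc N n ≈ h n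
    go ≤′-refl          = sym (h≈hTrunc n)
    go (≤′-step n≤′N) = trans (hTrunc-stable _ n (≤′⇒≤ n≤′N)) (go n≤′N)

  h-zero : h 0 ≈ 1#
  h-zero = trans (h≈hTrunc 0) (trans (+-identityʳ _) (*-identityˡ 1#))

  h-odd : ∀ m → h (1 ℕ.+ 2 ℕ.* m) ≈ q * h m
  h-odd m = begin
    h (1 ℕ.+ 2 ℕ.* m)                    ≈⟨ h≈hTrunc (1 ℕ.+ 2 ℕ.* m) ⟩
    hTrunc (1 ℕ.+ 2 ℕ.* m) (1 ℕ.+ 2 ℕ.* m) ≈⟨ hTrunc-odd (2 ℕ.* m) m ⟩
    q * hTrunc (2 ℕ.* m) m               ≈⟨ *-congˡ (hTrunc≈h (2 ℕ.* m) (m≤n*m m 2)) ⟩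
    q * h m                              ∎

  h-even : ∀ j → h (2 ℕ.* suc j) ≈ h (suc j) + q * (q * h j)
  h-even j = begin
    h (2 ℕ.* suc j)                          ≈⟨ h≈hTrunc (2 ℕ.* suc j) ⟩
    hTrunc (2 ℕ.* suc j) (2 ℕ.* suc j)       ≈⟨ hTrunc-even N j ⟩
    hTrunc N (suc j) + q * (q * hTrunc N j)
      ≈⟨ +-cong (hTrunc≈h N 1+j≤N) (*-congˡ (*-congˡ (hTrunc≈h N (≤-trans (n≤1+n j) 1+j≤N)))) ⟩
    h (suc j) + q * (q * h j)                ∎
    where
    N = ℕ.pred (2 ℕ.* suc j)
    1+j≤N : suc j ≤ N
    1+j≤N = ≤-pred (m<m+n (suc j) (s≤s z≤n))

module TransferMatrices {c ℓ} (R : CommutativeRing c ℓ) (q q⁻ : CommutativeRing.Carrier R) where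
  open CommutativeRing R
  open Over R q q⁻
  open HyperbinaryRecurrences R q q⁻ using (h-zero; h-odd; h-even)
  open import Algebra.Properties.CommutativeSemigroup *-commutativeSemigroup using (x∙yz≈y∙xz; interchange)
  open Algebra.Solver.Ring.NaturalCoefficients.Default commutativeSemiring using (solve; _:+_; _:*_; _:=_; con)
  import Relation.Binary.Reasoning.Setoid as SetoidReasoning

  infix 4 _≋_
  _≋_ : Carrier × Carrier → Carrier × Carrier → Set ℓ
  _≋_ = Pointwise _≈_ _≈_

  M-∷ : ∀ {n m b} → bitsLSB n ≡ b ∷ bitsLSB (suc m) → M n ≡ letter b ⊗ M (suc m)
  M-∷ {m = m} {b} eq = ≡.trans (cong (prod ∘ dropLast) eq) (cong prod (dropLast-∷ b {bitsLSB (suc m)} (λ ())))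

  M-even : ∀ j → M (2 ℕ.* suc j) ≡ L ⊗ M (suc j)
  M-even j = M-∷ (bitsLSB-even j)

  M-odd : ∀ j → M (1 ℕ.+ 2 ℕ.* suc j) ≡ Rm ⊗ M (suc j)
  M-odd j = M-∷ (bitsLSB-odd (suc j))

  ·-⊗ : ∀ A B v → (A ⊗ B) · v ≋ A · (B · v)
  ·-⊗ ((a , b) , (c′ , d)) ((e , f) , (g , k)) (x , y) =
    solve 8 (λ a b e f g k x y → (a :* e :+ b :* g) :* x :+ (a :* f :+ b :* k) :* y
                                := a :* (e :* x :+ f :* y) :+ b :* (g :* x :+ k :* y)) refl a b e f g k x y ,
    solve 8 (λ c d e f g k x y → (c :* e :+ d :* g) :* x :+ (c :* f :+ d :* k) :* y
                                := c :* (e :* x :+ f :* y) :+ d :* (g :* x :+ k :* y)) refl c′ d e f g k x y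

  ·-cong : ∀ A {v w} → v ≋ w → A · v ≋ A · w
  ·-cong A (x≈ , y≈) = +-cong (*-congˡ x≈) (*-congˡ y≈) , +-cong (*-congˡ x≈) (*-congˡ y≈)

  module _ (q*q⁻≈1 : q * q⁻ ≈ 1#) where

    q⁻-shift : ∀ x y → x * y ≈ (q⁻ * x) * (q * y)
    q⁻-shift x y = sym (begin
      (q⁻ * x) * (q * y)  ≈⟨ interchange q⁻ x q y ⟩
      (q⁻ * q) * (x * y)  ≈⟨ *-congʳ (trans (*-comm q⁻ q) q*q⁻≈1) ⟩
      1# * (x * y)        ≈⟨ *-identityˡ _ ⟩
      x * y               ∎)
      where open SetoidReasoning setoid

    L-step : ∀ u a b → L · (u * a , (q⁻ * u) * b) ≋ ((q⁻ * u) * (q * a) , (q⁻ * (q⁻ * u)) * (b + q * (q * a)))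
    L-step u a b = first , second
      where
      first : 1# * (u * a) + 0# * ((q⁻ * u) * b) ≈ (q⁻ * u) * (q * a)
      first = trans (trans (+-cong (*-identityˡ _) (zeroˡ _)) (+-identityʳ _)) (q⁻-shift u a)
      second : 1# * (u * a) + q⁻ * ((q⁻ * u) * b) ≈ (q⁻ * (q⁻ * u)) * (b + q * (q * a))
      second = begin
        1# * (u * a) + q⁻ * ((q⁻ * u) * b)
          ≈⟨ +-congʳ (*-congˡ (trans (q⁻-shift u a) (q⁻-shift (q⁻ * u) (q * a)))) ⟩
        1# * ((q⁻ * (q⁻ * u)) * (q * (q * a))) + q⁻ * ((q⁻ * u) * b)
          ≈⟨ solve 4 (λ q⁻ w X b → con 1 :* ((q⁻ :* w) :* X) :+ q⁻ :* (w :* b) := (q⁻ :* w) :* (b :+ X))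
                     refl q⁻ (q⁻ * u) (q * (q * a)) b ⟩
        (q⁻ * (q⁻ * u)) * (b + q * (q * a)) ∎
        where open SetoidReasoning setoid

    R-step : ∀ u a b → Rm · (u * a , (q⁻ * u) * b) ≋ ((q⁻ * u) * (b + q * (q * a)) , (q⁻ * (q⁻ * u)) * (q * b))
    R-step u a b = first , second
      where
      first : q * (u * a) + 1# * ((q⁻ * u) * b) ≈ (q⁻ * u) * (b + q * (q * a))
      first = begin
        q * (u * a) + 1# * ((q⁻ * u) * b)
          ≈⟨ +-congʳ (trans (x∙yz≈y∙xz q u a) (q⁻-shift u (q * a))) ⟩
        (q⁻ * u) * (q * (q * a)) + 1# * ((q⁻ * u) * b)
          ≈⟨ solve 3 (λ w X b → w :* X :+ con 1 :* (w :* b) := w :* (b :+ X)) refl (q⁻ * u) (q * (q * a)) b ⟩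
        (q⁻ * u) * (b + q * (q * a)) ∎
        where open SetoidReasoning setoid
      second : 0# * (u * a) + 1# * ((q⁻ * u) * b) ≈ (q⁻ * (q⁻ * u)) * (q * b)
      second = trans (trans (+-cong (zeroˡ _) (*-identityˡ _)) (+-identityˡ _)) (q⁻-shift (q⁻ * u) b)

    ColumnFormula : Carrier → ℕ → Set ℓ
    ColumnFormula u n = M n · (1# , 1#) ≋ (u * h (n ∸ 1) , (q⁻ * u) * h n)

    columnFormula-1 : ColumnFormula 1# 1
    columnFormula-1 = first , second
      where
      first : 1# * 1# + 0# * 1# ≈ 1# * h 0
      first = trans (trans (+-congˡ (zeroˡ 1#)) (+-identityʳ _)) (*-congˡ (sym h-zero))
      second : 0# * 1# + 1# * 1# ≈ (q⁻ * 1#) * h 1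
      second = begin
        0# * 1# + 1# * 1#     ≈⟨ trans (+-congʳ (zeroˡ 1#)) (+-identityˡ _) ⟩
        1# * 1#               ≈⟨ q⁻-shift 1# 1# ⟩
        (q⁻ * 1#) * (q * 1#)  ≈⟨ *-congˡ (*-congˡ h-zero) ⟨
        (q⁻ * 1#) * (q * h 0) ≈⟨ *-congˡ (h-odd 0) ⟨
        (q⁻ * 1#) * h 1       ∎
        where open SetoidReasoning setoid

    columnFormula-even : ∀ {u} j → ColumnFormula u (suc j) → ColumnFormula (q⁻ * u) (2 ℕ.* suc j)
    columnFormula-even {u} j inv = begin
      M (2 ℕ.* suc j) · 𝟙                   ≡⟨ cong (_· 𝟙) (M-even j) ⟩
      (L ⊗ M (suc j)) · 𝟙                   ≈⟨ ·-⊗ L (M (suc j)) 𝟙 ⟩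
      L · (M (suc j) · 𝟙)                   ≈⟨ ·-cong L inv ⟩
      L · (u * h j , (q⁻ * u) * h (suc j))  ≈⟨ L-step u (h j) (h (suc j)) ⟩
      ((q⁻ * u) * (q * h j) , (q⁻ * (q⁻ * u)) * (h (suc j) + q * (q * h j)))
        ≈⟨ *-congˡ (h-odd j) , *-congˡ (h-even j) ⟨
      ((q⁻ * u) * h (1 ℕ.+ 2 ℕ.* j) , (q⁻ * (q⁻ * u)) * h (2 ℕ.* suc j))
        ≡⟨ cong (λ n → ((q⁻ * u) * h n , (q⁻ * (q⁻ * u)) * h (2 ℕ.* suc j))) (cong (_∸ 1) (*-suc 2 j)) ⟨
      ((q⁻ * u) * h (2 ℕ.* suc j ∸ 1) , (q⁻ * (q⁻ * u)) * h (2 ℕ.* suc j)) ∎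
      where
      open SetoidReasoning (×-setoid setoid setoid)
      𝟙 = (1# , 1#)

    columnFormula-odd : ∀ {u} j → ColumnFormula u (suc j) → ColumnFormula (q⁻ * u) (1 ℕ.+ 2 ℕ.* suc j)
    columnFormula-odd {u} j inv = begin
      M (1 ℕ.+ 2 ℕ.* suc j) · 𝟙             ≡⟨ cong (_· 𝟙) (M-odd j) ⟩
      (Rm ⊗ M (suc j)) · 𝟙                  ≈⟨ ·-⊗ Rm (M (suc j)) 𝟙 ⟩
      Rm · (M (suc j) · 𝟙)                  ≈⟨ ·-cong Rm inv ⟩
      Rm · (u * h j , (q⁻ * u) * h (suc j)) ≈⟨ R-step u (h j) (h (suc j)) ⟩
      ((q⁻ * u) * (h (suc j) + q * (q * h j)) , (q⁻ * (q⁻ * u)) * (q * h (suc j)))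
        ≈⟨ *-congˡ (h-even j) , *-congˡ (h-odd (suc j)) ⟨
      ((q⁻ * u) * h (2 ℕ.* suc j) , (q⁻ * (q⁻ * u)) * h (1 ℕ.+ 2 ℕ.* suc j)) ∎
      where
      open SetoidReasoning (×-setoid setoid setoid)
      𝟙 = (1# , 1#)

    columnFormula : ∀ k n → 2 ^ k ≤ n → n < 2 ^ suc k → ColumnFormula (pow q⁻ k) n
    columnFormula zero    zero          ()  _
    columnFormula zero    (suc zero)    _   _               = columnFormula-1
    columnFormula zero    (suc (suc n)) _   (s≤s (s≤s ()))
    columnFormula (suc k) n             lo  hi with evenOdd n
    ... | even zero    = contradiction (*-cancelˡ-≤ 2 lo) (<⇒≱ (m^n>0 2 k))
    ... | odd zero     = contradiction (2*m≤1+2*n⇒m≤n lo) (<⇒≱ (m^n>0 2 k))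
    ... | even (suc j) =
      columnFormula-even j (columnFormula k (suc j) (*-cancelˡ-≤ 2 lo) (*-cancelˡ-< 2 _ _ hi))
    ... | odd (suc j)  =
      columnFormula-odd j (columnFormula k (suc j) (2*m≤1+2*n⇒m≤n lo) (*-cancelˡ-< 2 _ _ (<-trans (n<1+n _) hi)))

theorem4p3 : ∀ {c ℓ} (R : CommutativeRing c ℓ) (q q⁻ : CommutativeRing.Carrier R) →
    CommutativeRing._≈_ R (CommutativeRing._*_ R q q⁻) (CommutativeRing.1# R) →
    (k n : ℕ) → 2 ^ k ≤ n → n < 2 ^ suc k →
    let open CommutativeRing R
        open Over R q q⁻
    in (fst (M n · (1# , 1#)) ≈ pow q⁻ k * h (n ∸ 1))
       × (snd (M n · (1# , 1#)) ≈ pow q⁻ (suc k) * h n)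
theorem4p3 R q q⁻ q*q⁻≈1 = TransferMatrices.columnFormula R q q⁻ q*q⁻≈1
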